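{- Let $G$ be a simple undirected graph with integral weights $0<w(v)\leq W$ on its vertices, and let $(L,S,R)$ be a global minimum vertex-cut in $G$. Let $x\in L$, let $\gamma>0$, and let $S'_\gamma$ be the set of all vertices $v\in S\setminus N_G(x)$ with $w(v)\geq W/\gamma$. Then $|S'_\gamma|\leq|L|\cdot\gamma$.
   Context: A vertex-cut of $G$ is a partition $(L,S,R)$ of $V(G)$ with $L,R\neq\emptyset$ and no edge between $L$ and $R$; its value is $w(S)=\sum_{v\in S}w(v)$, and a global minimum vertex-cut is one of minimum value. By convention $w(L)\leq w(R)$. $N_G(x)$ denotes the neighbor set of $x$.
   Formalization: The parameter γ ranges over the positive rationals. -}

module Defs where

open import Data.Nat using (ℕ; _≤_; _<_)
open import Data.Fin using (Fin)
open import Data.Bool using (Bool; true; false; T; _∧_; not)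
open import Data.List using (List; length; filter; map)
open import Data.Nat.ListAction using (sum)
open import Data.List.Base using (allFin)
open import Data.Product using (_×_; Σ; ∃)
open import Relation.Nullary using (¬_)
open import Relation.Binary.PropositionalEquality using (_≡_)
open import Relation.Unary using (Pred; Decidable)

record Graph (n : ℕ) : Set where
  field
    adj       : Fin n → Fin n → Bool
    adj-sym   : ∀ u v → adj u v ≡ adj v u
    adj-irrefl : ∀ v → adj v v ≡ false

open Graph public

data Side : Set where
  sL sS sR : Side

isL isS isR : Side → Bool
isL sL = true
isL _  = false
isS sS = true
isS _  = false
isR sR = true
isR _  = false

count : ∀ {n} → (Fin n → Bool) → ℕ
count {n} p = length (filter (λ v → Data.Bool._≟_ (p v) true) (allFin n))

wsum : ∀ {n} → (Fin n → ℕ) → (Fin n → Bool) → ℕ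
wsum {n} w p = sum (map w (filter (λ v → Data.Bool._≟_ (p v) true) (allFin n)))

record IsVertexCut {n} (G : Graph n) (side : Fin n → Side) : Set where
  field
    L-nonempty : ∃ λ v → side v ≡ sL
    R-nonempty : ∃ λ v → side v ≡ sR
    no-LR-edge : ∀ u v → side u ≡ sL → side v ≡ sR → adj G u v ≡ false

cutValue : ∀ {n} → (Fin n → ℕ) → (Fin n → Side) → ℕ
cutValue w side = wsum w (λ v → isS (side v))

record IsGlobalMinVertexCut {n} (G : Graph n) (w : Fin n → ℕ) (side : Fin n → Side) : Set where
  field
    isCut   : IsVertexCut G side
    minimal : ∀ side' → IsVertexCut G side' → cutValue w side ≤ cutValue w side'
    wL≤wR   : wsum w (λ v → isL (side v)) ≤ wsum w (λ v → isR (side v))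

open import Data.Rational as ℚ using (ℚ; Positive; _÷_; _≤ᵇ_) 
open import Data.Rational.Properties as ℚP using (pos⇒nonZero)
open import Data.Integer using (+_)

⟦_⟧ : ℕ → ℚ
⟦ k ⟧ = + k ℚ./ 1

S'γ : ∀ {n} (G : Graph n) (w : Fin n → ℕ) (side : Fin n → Side) (x : Fin n)
      (W : ℕ) (γ : ℚ) → .{{Positive γ}} → Fin n → Bool
S'γ G w side x W γ {{γ>0}} v =
  isS (side v) ∧ not (adj G x v) ∧ ((⟦ W ⟧ ÷ γ) {{pos⇒nonZero γ}} ≤ᵇ ⟦ w v ⟧)

{-# OPTIONS --safe #-}
-- Since x ∈ L has no neighbour in R, ({x}, N(x), V ∖ N[x]) is again a vertex cut, so minimality
-- gives w(S) ≤ w(N(x)). Every neighbour of x lies in L or in S ∩ N(x), hence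
-- w(S ∖ N(x)) + w(N(x)) ≤ w(L) + w(S), and therefore w(S ∖ N(x)) ≤ w(L) ≤ |L| W. Each vertex of
-- S'γ ⊆ S ∖ N(x) weighs at least W/γ, so |S'γ| W/γ ≤ |L| W; dividing by W > 0 gives the claim.
module Submission where

open import Defs
open import Data.Nat using (ℕ; _<_; _≤_)
open import Data.Fin using (Fin)
open import Data.Rational using (ℚ; Positive)
open import Relation.Binary.PropositionalEquality using (_≡_)

open import Data.Bool using (Bool; true; false; T; _∧_; not; if_then_else_)
open import Data.Empty using (⊥-elim)
open import Data.Fin.Properties using () renaming (_≟_ to _≟ᶠ_)
open import Data.Integer as ℤ using (+_)
import Data.Integer.Properties as ℤ
open import Data.List using (List; []; _∷_; length; filter; map; allFin)
open import Data.Nat as ℕ using (suc; z≤n)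
open import Data.Nat.ListAction using (sum)
import Data.Nat.Coprimality as Coprimality
import Data.Nat.Properties as ℕ
open import Algebra.Properties.CommutativeSemigroup ℕ.+-commutativeSemigroup
  using () renaming (interchange to +-interchange)
open import Data.Product using (_,_; map₂)
open import Data.Rational as ℚ using (mkℚ; _÷_; 1/_)
import Data.Rational.Properties as ℚ
open import Data.Rational.Solver using (module +-*-Solver)
open import Function using (_∘_)
open import Relation.Nullary using (does; yes; no)
open import Relation.Binary.PropositionalEquality
  using (refl; sym; trans; cong; cong₂; subst; subst₂; module ≡-Reasoning)

⟦⟧≡mkℚ : ∀ k → ⟦ k ⟧ ≡ mkℚ (+ k) 0 (Coprimality.sym (Coprimality.1-coprimeTo k))
⟦⟧≡mkℚ k = ℚ.normalize-coprime (Coprimality.sym (Coprimality.1-coprimeTo k))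

⟦⟧-homo-+ : ∀ a b → ⟦ a ℕ.+ b ⟧ ≡ ⟦ a ⟧ ℚ.+ ⟦ b ⟧
⟦⟧-homo-+ a b = begin
  + (a ℕ.+ b) ℚ./ 1                        ≡⟨ cong (ℚ._/ 1) (ℤ.pos-+ a b) ⟩
  (+ a ℤ.+ + b) ℚ./ 1                      ≡⟨ cong (ℚ._/ 1) (cong₂ ℤ._+_ (ℤ.*-identityʳ (+ a)) (ℤ.*-identityʳ (+ b))) ⟨
  (+ a ℤ.* + 1 ℤ.+ + b ℤ.* + 1) ℚ./ 1      ≡⟨ cong₂ ℚ._+_ (⟦⟧≡mkℚ a) (⟦⟧≡mkℚ b) ⟨
  ⟦ a ⟧ ℚ.+ ⟦ b ⟧                          ∎
  where open ≡-Reasoning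

⟦⟧-homo-* : ∀ a b → ⟦ a ℕ.* b ⟧ ≡ ⟦ a ⟧ ℚ.* ⟦ b ⟧
⟦⟧-homo-* a b = begin
  + (a ℕ.* b) ℚ./ 1     ≡⟨ cong (ℚ._/ 1) (ℤ.pos-* a b) ⟩
  (+ a ℤ.* + b) ℚ./ 1   ≡⟨ cong₂ ℚ._*_ (⟦⟧≡mkℚ a) (⟦⟧≡mkℚ b) ⟨
  ⟦ a ⟧ ℚ.* ⟦ b ⟧       ∎
  where open ≡-Reasoning

⟦⟧-mono-≤ : ∀ {a b} → a ≤ b → ⟦ a ⟧ ℚ.≤ ⟦ b ⟧
⟦⟧-mono-≤ {a} {b} a≤b rewrite ⟦⟧≡mkℚ a | ⟦⟧≡mkℚ b =
  ℚ.*≤* (subst₂ ℤ._≤_ (sym (ℤ.*-identityʳ (+ a))) (sym (ℤ.*-identityʳ (+ b))) (ℤ.+≤+ a≤b))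

⟦⟧-pos : ∀ {k} → 0 < k → Positive ⟦ k ⟧
⟦⟧-pos {suc k} _ = ℚ.normalize-pos (suc k) 1

c*[W÷γ]≤a*W⇒c≤a*γ : ∀ (c a W γ : ℚ) .{{_ : Positive W}} .{{_ : Positive γ}} →
            c ℚ.* (W ÷ γ) {{ℚ.pos⇒nonZero γ}} ℚ.≤ a ℚ.* W → c ℚ.≤ a ℚ.* γ
c*[W÷γ]≤a*W⇒c≤a*γ c a W γ c*W/γ≤a*W = ℚ.*-cancelʳ-≤-pos W (begin
  c ℚ.* W                              ≡⟨ ℚ.*-identityʳ (c ℚ.* W) ⟨
  c ℚ.* W ℚ.* ℚ.1ℚ                     ≡⟨ cong (c ℚ.* W ℚ.*_) (ℚ.*-inverseˡ γ) ⟨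
  c ℚ.* W ℚ.* (1/ γ ℚ.* γ)             ≡⟨ solve 4 (λ c W i γ → c :* W :* (i :* γ) := c :* (W :* i) :* γ)
                                                 refl c W (1/ γ) γ ⟩
  c ℚ.* (W ÷ γ) ℚ.* γ                  ≤⟨ ℚ.*-monoʳ-≤-nonNeg γ c*W/γ≤a*W ⟩
  a ℚ.* W ℚ.* γ                        ≡⟨ solve 3 (λ a W γ → a :* W :* γ := a :* γ :* W) refl a W γ ⟩
  a ℚ.* γ ℚ.* W                        ∎)
  where
  open ℚ.≤-Reasoning
  open +-*-Solver
  instance
    γ≢0 : ℚ.NonZero γ
    γ≢0 = ℚ.pos⇒nonZero γ
    γ≥0 : ℚ.NonNegative γ
    γ≥0 = ℚ.pos⇒nonNeg γ

module _ {A : Set} where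

  sum-map-mono-≤ : ∀ {f g : A → ℕ} → (∀ v → f v ≤ g v) → ∀ l → sum (map f l) ≤ sum (map g l)
  sum-map-mono-≤ f≤g []      = z≤n
  sum-map-mono-≤ f≤g (v ∷ l) = ℕ.+-mono-≤ (f≤g v) (sum-map-mono-≤ f≤g l)

  sum-map-+ : ∀ (f g : A → ℕ) l →
              sum (map (λ v → f v ℕ.+ g v) l) ≡ sum (map f l) ℕ.+ sum (map g l)
  sum-map-+ f g []      = refl
  sum-map-+ f g (v ∷ l) = begin
    f v ℕ.+ g v ℕ.+ sum (map (λ v → f v ℕ.+ g v) l)   ≡⟨ cong (f v ℕ.+ g v ℕ.+_) (sum-map-+ f g l) ⟩
    f v ℕ.+ g v ℕ.+ (sum (map f l) ℕ.+ sum (map g l))  ≡⟨ +-interchange (f v) (g v) _ _ ⟩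
    f v ℕ.+ sum (map f l) ℕ.+ (g v ℕ.+ sum (map g l))  ∎
    where open ≡-Reasoning

-- wsum w p and count p of Defs are weight w p (allFin n) and size p (allFin n) by unfolding.
module _ {A : Set} where

  select : (A → Bool) → List A → List A
  select p = filter (λ v → p v Data.Bool.≟ true)

  size : (A → Bool) → List A → ℕ
  size p l = length (select p l)

module _ {A : Set} (w : A → ℕ) where

  weight : (A → Bool) → List A → ℕ
  weight p l = sum (map w (select p l))

  restrict : (A → Bool) → A → ℕ
  restrict p v = if p v then w v else 0

  weight≡sum-restrict : ∀ p l → weight p l ≡ sum (map (restrict p) l)
  weight≡sum-restrict p []      = refl
  weight≡sum-restrict p (v ∷ l) with p v
  ... | true  = cong (w v ℕ.+_) (weight≡sum-restrict p l)
  ... | false = weight≡sum-restrict p l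

  weight-mono : ∀ {p q} → (∀ v → T (p v) → T (q v)) → ∀ l → weight p l ≤ weight q l
  weight-mono {p} {q} p⊆q l = begin
    weight p l                ≡⟨ weight≡sum-restrict p l ⟩
    sum (map (restrict p) l)  ≤⟨ sum-map-mono-≤ restrict-mono l ⟩
    sum (map (restrict q) l)  ≡⟨ weight≡sum-restrict q l ⟨
    weight q l                ∎
    where
    open ℕ.≤-Reasoning
    restrict-mono : ∀ v → restrict p v ≤ restrict q v
    restrict-mono v with p v | q v | p⊆q v
    ... | false | _     | _    = z≤n
    ... | true  | true  | _    = ℕ.≤-refl
    ... | true  | false | p⇒q = ⊥-elim (p⇒q _)

  weight-+-mono : ∀ p q r s → (∀ v → restrict p v ℕ.+ restrict q v ≤ restrict r v ℕ.+ restrict s v) →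
                  ∀ l → weight p l ℕ.+ weight q l ≤ weight r l ℕ.+ weight s l
  weight-+-mono p q r s pq≤rs l = begin
    weight p l ℕ.+ weight q l
      ≡⟨ cong₂ ℕ._+_ (weight≡sum-restrict p l) (weight≡sum-restrict q l) ⟩
    sum (map (restrict p) l) ℕ.+ sum (map (restrict q) l)
      ≡⟨ sum-map-+ (restrict p) (restrict q) l ⟨
    sum (map (λ v → restrict p v ℕ.+ restrict q v) l)
      ≤⟨ sum-map-mono-≤ pq≤rs l ⟩
    sum (map (λ v → restrict r v ℕ.+ restrict s v) l)
      ≡⟨ sum-map-+ (restrict r) (restrict s) l ⟩
    sum (map (restrict r) l) ℕ.+ sum (map (restrict s) l)
      ≡⟨ cong₂ ℕ._+_ (weight≡sum-restrict r l) (weight≡sum-restrict s l) ⟨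
    weight r l ℕ.+ weight s l
      ∎
    where open ℕ.≤-Reasoning

  weight≤size*max : ∀ {W} → (∀ v → w v ≤ W) → ∀ p l → weight p l ≤ size p l ℕ.* W
  weight≤size*max w≤W p []      = z≤n
  weight≤size*max w≤W p (v ∷ l) with p v
  ... | true  = ℕ.+-mono-≤ (w≤W v) (weight≤size*max w≤W p l)
  ... | false = weight≤size*max w≤W p l

  size*min≤weight : ∀ {q p} → (∀ v → T (p v) → q ℚ.≤ ⟦ w v ⟧) →
                    ∀ l → ⟦ size p l ⟧ ℚ.* q ℚ.≤ ⟦ weight p l ⟧
  size*min≤weight {q}     q≤w []      = ℚ.≤-reflexive (ℚ.*-zeroˡ q)
  size*min≤weight {q} {p} q≤w (v ∷ l) with p v | q≤w v
  ... | false | _      = size*min≤weight q≤w l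
  ... | true  | q≤w[v] = begin
    ⟦ 1 ℕ.+ size p l ⟧ ℚ.* q              ≡⟨ cong (ℚ._* q) (⟦⟧-homo-+ 1 (size p l)) ⟩
    (ℚ.1ℚ ℚ.+ ⟦ size p l ⟧) ℚ.* q          ≡⟨ ℚ.*-distribʳ-+ q ℚ.1ℚ ⟦ size p l ⟧ ⟩
    ℚ.1ℚ ℚ.* q ℚ.+ ⟦ size p l ⟧ ℚ.* q     ≡⟨ cong (ℚ._+ ⟦ size p l ⟧ ℚ.* q) (ℚ.*-identityˡ q) ⟩
    q ℚ.+ ⟦ size p l ⟧ ℚ.* q               ≤⟨ ℚ.+-mono-≤ (q≤w[v] _) (size*min≤weight q≤w l) ⟩
    ⟦ w v ⟧ ℚ.+ ⟦ weight p l ⟧             ≡⟨ ⟦⟧-homo-+ (w v) (weight p l) ⟨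
    ⟦ w v ℕ.+ weight p l ⟧                 ∎
    where open ℚ.≤-Reasoning

neighbourhoodCut : ∀ {n} → Graph n → Fin n → Fin n → Side
neighbourhoodCut G x v = if adj G x v then sS else if does (v ≟ᶠ x) then sL else sR

module _ {n} (G : Graph n) (x : Fin n) where

  isS-neighbourhoodCut : ∀ v → isS (neighbourhoodCut G x v) ≡ adj G x v
  isS-neighbourhoodCut v with adj G x v | v ≟ᶠ x
  ... | true  | _     = refl
  ... | false | yes _ = refl
  ... | false | no _  = refl

  neighbourhoodCut-L : ∀ u → neighbourhoodCut G x u ≡ sL → u ≡ x
  neighbourhoodCut-L u with adj G x u | u ≟ᶠ x
  ... | true  | _       = λ ()
  ... | false | yes u≡x = λ _ → u≡x
  ... | false | no _    = λ ()

  neighbourhoodCut-R : ∀ v → neighbourhoodCut G x v ≡ sR → adj G x v ≡ false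
  neighbourhoodCut-R v with adj G x v
  ... | true  = λ ()
  ... | false = λ _ → refl

  neighbourhoodCut-x : neighbourhoodCut G x x ≡ sL
  neighbourhoodCut-x with adj G x x | adj-irrefl G x | x ≟ᶠ x
  ... | false | _ | yes _   = refl
  ... | false | _ | no x≢x = ⊥-elim (x≢x refl)

  neighbourhoodCut-isVertexCut : ∀ {side} → IsVertexCut G side → side x ≡ sL →
                                 IsVertexCut G (neighbourhoodCut G x)
  neighbourhoodCut-isVertexCut {side} cut x∈L = record
    { L-nonempty = x , neighbourhoodCut-x
    ; R-nonempty = map₂ R-stays R-nonempty
    ; no-LR-edge = λ u v u∈L′ v∈R′ →
        subst (λ u → adj G u v ≡ false) (sym (neighbourhoodCut-L u u∈L′)) (neighbourhoodCut-R v v∈R′)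
    }
    where
    open IsVertexCut cut
    R-stays : ∀ {r} → side r ≡ sR → neighbourhoodCut G x r ≡ sR
    R-stays {r} r∈R with adj G x r | no-LR-edge x r x∈L r∈R | r ≟ᶠ x
    ... | false | _ | no _    = refl
    ... | false | _ | yes refl with trans (sym x∈L) r∈R
    ...   | ()

-- The per-vertex form of N(x) ⊆ L ∪ S, with a the adjacency to x: the hypothesis is that x ∈ L
-- has no neighbour in R.
[S∧¬a]+[a]≤[L]+[S] : ∀ s a k → (s ≡ sR → a ≡ false) →
  (if isS s ∧ not a then k else 0) ℕ.+ (if a then k else 0)
    ≤ (if isL s then k else 0) ℕ.+ (if isS s then k else 0)
[S∧¬a]+[a]≤[L]+[S] sL false k _    = z≤n
[S∧¬a]+[a]≤[L]+[S] sL true  k _    = ℕ.m≤m+n k 0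
[S∧¬a]+[a]≤[L]+[S] sS false k _    = ℕ.≤-reflexive (ℕ.+-identityʳ k)
[S∧¬a]+[a]≤[L]+[S] sS true  k _    = ℕ.≤-refl
[S∧¬a]+[a]≤[L]+[S] sR a     k a≡ff rewrite a≡ff refl = z≤n

module _ {n} {G : Graph n} (w : Fin n → ℕ) {side : Fin n → Side} {x : Fin n} (x∈L : side x ≡ sL) where

  weight[S∖N]+weight[N]≤weight[L]+weight[S] : IsVertexCut G side →
    wsum w (λ v → isS (side v) ∧ not (adj G x v)) ℕ.+ cutValue w (neighbourhoodCut G x)
      ≤ wsum w (λ v → isL (side v)) ℕ.+ cutValue w side
  weight[S∖N]+weight[N]≤weight[L]+weight[S] cut = weight-+-mono w _ _ _ _ exchange (allFin n)
    where
    exchange : ∀ v → restrict w (λ v → isS (side v) ∧ not (adj G x v)) v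
                       ℕ.+ restrict w (isS ∘ neighbourhoodCut G x) v
                     ≤ restrict w (isL ∘ side) v ℕ.+ restrict w (isS ∘ side) v
    exchange v rewrite isS-neighbourhoodCut G x v =
      [S∧¬a]+[a]≤[L]+[S] (side v) (adj G x v) (w v) (IsVertexCut.no-LR-edge cut x v x∈L)

  weight[S∖N]≤weight[L] : IsGlobalMinVertexCut G w side →
    wsum w (λ v → isS (side v) ∧ not (adj G x v)) ≤ wsum w (λ v → isL (side v))
  weight[S∖N]≤weight[L] minCut = ℕ.+-cancelʳ-≤ (cutValue w (neighbourhoodCut G x)) _ _ (begin
    wsum w (λ v → isS (side v) ∧ not (adj G x v)) ℕ.+ cutValue w (neighbourhoodCut G x)
      ≤⟨ weight[S∖N]+weight[N]≤weight[L]+weight[S] isCut ⟩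
    wsum w (λ v → isL (side v)) ℕ.+ cutValue w side
      ≤⟨ ℕ.+-monoʳ-≤ _ (minimal _ (neighbourhoodCut-isVertexCut G x isCut x∈L)) ⟩
    wsum w (λ v → isL (side v)) ℕ.+ cutValue w (neighbourhoodCut G x) ∎)
    where
    open IsGlobalMinVertexCut minCut
    open ℕ.≤-Reasoning

module _ {n} (G : Graph n) (w : Fin n → ℕ) (side : Fin n → Side) (x : Fin n) (W : ℕ)
         (γ : ℚ) .{{_ : Positive γ}} where

  S'γ⊆S∖N : ∀ v → T (S'γ G w side x W γ v) → T (isS (side v) ∧ not (adj G x v))
  S'γ⊆S∖N v with isS (side v) | adj G x v
  ... | true  | false = _
  ... | true  | true  = λ ()
  ... | false | _     = λ ()

  S'γ-heavy : ∀ v → T (S'γ G w side x W γ v) → (⟦ W ⟧ ÷ γ) {{ℚ.pos⇒nonZero γ}} ℚ.≤ ⟦ w v ⟧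
  S'γ-heavy v with isS (side v) | adj G x v
  ... | true  | false = ℚ.≤ᵇ⇒≤
  ... | true  | true  = λ ()
  ... | false | _     = λ ()

corollary2p3 : ∀ {n} (G : Graph n) (w : Fin n → ℕ) (W : ℕ)
    → (∀ v → 0 < w v) → (∀ v → w v ≤ W)
    → (side : Fin n → Side) → IsGlobalMinVertexCut G w side
    → (x : Fin n) → side x ≡ sL
    → (γ : ℚ) → .{{_ : Positive γ}}
    → ⟦ count (S'γ G w side x W γ) ⟧ Data.Rational.≤ ⟦ count (λ v → isL (side v)) ⟧ Data.Rational.* γ
corollary2p3 {n} G w W w>0 w≤W side minCut x x∈L γ =
  c*[W÷γ]≤a*W⇒c≤a*γ ⟦ count S'ᵧ ⟧ ⟦ count L ⟧ ⟦ W ⟧ γ {{⟦⟧-pos (ℕ.<-≤-trans (w>0 x) (w≤W x))}} (begin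
    ⟦ count S'ᵧ ⟧ ℚ.* (⟦ W ⟧ ÷ γ) ≤⟨ size*min≤weight w (S'γ-heavy G w side x W γ) (allFin n) ⟩
    ⟦ wsum w S'ᵧ ⟧                ≤⟨ ⟦⟧-mono-≤ S'ᵧ-weight-bound ⟩
    ⟦ count L ℕ.* W ⟧             ≡⟨ ⟦⟧-homo-* (count L) W ⟩
    ⟦ count L ⟧ ℚ.* ⟦ W ⟧         ∎)
  where
  S'ᵧ L : Fin n → Bool
  S'ᵧ = S'γ G w side x W γ
  L = isL ∘ side
  instance
    γ≢0 : ℚ.NonZero γ
    γ≢0 = ℚ.pos⇒nonZero γ
  S'ᵧ-weight-bound : wsum w S'ᵧ ≤ count L ℕ.* W
  S'ᵧ-weight-bound = ℕ.≤-trans (weight-mono w (S'γ⊆S∖N G w side x W γ) (allFin n))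
                    (ℕ.≤-trans (weight[S∖N]≤weight[L] w x∈L minCut) (weight≤size*max w w≤W L (allFin n)))
  open ℚ.≤-Reasoning
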